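{- Let $C$ be an $X$-neighbour transitive code in $H(m,q)$ with minimum distance $\delta\geq 3$, let $\mathcal{J}$ be an $X$-invariant partition of $M=\{1,\ldots,m\}$ and $J\in\mathcal{J}$. If $\pi_J(C)$ is not the complete code in $H(J,q)$, then $\pi_J(C)$ has minimum distance at least $2$.
   Context: $H(m,q)$ is the Hamming graph on $Q^m$, $|Q|=q$; $\mathrm{Aut}(H(m,q))=S_q^m\rtimes S_m$, elements written $h\sigma$ with $\sigma\in S_m$ permuting coordinates. For a code $D$, $D_1$ is the set of vertices at distance exactly $1$ from $D$; $D$ is $X$-neighbour transitive if $D$ and $D_1$ are $X$-orbits. A partition $\mathcal{J}$ of $M$ is $X$-invariant if $J^\sigma\in\mathcal{J}$ for all $J\in\mathcal{J}$ and $h\sigma\in X$. For $J=\{i_1<\cdots<i_k\}$, $\pi_J(C)=\{(\alpha_{i_1},\ldots,\alpha_{i_k}):\alpha\in C\}$, a code in $H(J,q)=H(|J|,q)$; the complete code is the whole vertex set. -}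

module Defs where

open import Data.Nat using (ℕ; zero; suc; _+_; _≤_)
open import Data.Fin using (Fin)
open import Data.Fin.Properties using (_≟_)
open import Data.Fin.Permutation using (Permutation′; _⟨$⟩ʳ_; _⟨$⟩ˡ_; _∘ₚ_; flip)
import Data.Fin.Permutation as P
open import Data.Fin.Subset using (Subset; inside; outside; ∣_∣; _∈_; _∩_; Nonempty; Empty)
open import Data.Vec using (Vec; []; _∷_; lookup; tabulate)
open import Data.Product using (Σ; ∃; _×_)
open import Data.Sum using (_⊎_)
open import Relation.Nullary using (¬_; does)
open import Relation.Binary.PropositionalEquality using (_≡_; _≢_)

Vertex : ℕ → ℕ → Set
Vertex m q = Vec (Fin q) m

Code : ℕ → ℕ → Set₁
Code m q = Vertex m q → Set

dist : ∀ {m q} → Vertex m q → Vertex m q → ℕ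
dist [] [] = 0
dist (a ∷ α) (b ∷ β) = if′ (does (a ≟ b)) + dist α β
  where
  open import Data.Bool using (Bool; true; false)
  if′ : Bool → ℕ
  if′ true = 0
  if′ false = 1

MinDistAtLeast : ∀ {m q} → ℕ → Code m q → Set
MinDistAtLeast k C = ∀ α β → C α → C β → α ≢ β → k ≤ dist α β

Complete : ∀ {m q} → Code m q → Set
Complete C = ∀ γ → C γ

DistFromCode : ∀ {m q} → Code m q → Vertex m q → ℕ → Set
DistFromCode D β k = (∃ λ γ → D γ × dist β γ ≡ k) × (∀ γ → D γ → k ≤ dist β γ)

Neighbours : ∀ {m q} → Code m q → Code m q
Neighbours D β = DistFromCode D β 1

record Aut (m q : ℕ) : Set where
  field
    h : Fin m → Permutation′ q
    σ : Permutation′ m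
open Aut public

-- Action: α^{hσ} has in position i the entry (α_{iσ⁻¹})^{h_{iσ⁻¹}}.
act : ∀ {m q} → Aut m q → Vertex m q → Vertex m q
act x α = tabulate λ i → h x (σ x ⟨$⟩ˡ i) ⟨$⟩ʳ lookup α (σ x ⟨$⟩ˡ i)

-- Group operations (product xy = first x, then y; right action).
idAut : ∀ {m q} → Aut m q
idAut = record { h = λ _ → P.id ; σ = P.id }

mulAut : ∀ {m q} → Aut m q → Aut m q → Aut m q
mulAut x y = record { h = λ l → h x l ∘ₚ h y (σ x ⟨$⟩ʳ l) ; σ = σ x ∘ₚ σ y }

invAut : ∀ {m q} → Aut m q → Aut m q
invAut x = record { h = λ k → flip (h x (σ x ⟨$⟩ˡ k)) ; σ = flip (σ x) }

_≈ᴬ_ : ∀ {m q} → Aut m q → Aut m q → Set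
x ≈ᴬ y = (∀ l i → h x l ⟨$⟩ʳ i ≡ h y l ⟨$⟩ʳ i) × (∀ i → σ x ⟨$⟩ʳ i ≡ σ y ⟨$⟩ʳ i)

record IsSubgroup {m q} (X : Aut m q → Set) : Set where
  field
    has-id  : ∃ λ e → X e × e ≈ᴬ idAut
    has-mul : ∀ x y → X x → X y → ∃ λ z → X z × z ≈ᴬ mulAut x y
    has-inv : ∀ x → X x → ∃ λ z → X z × z ≈ᴬ invAut x

IsOrbit : ∀ {m q} → (Aut m q → Set) → Code m q → Set
IsOrbit X D = ∃ λ α → ∀ β → (D β → ∃ λ x → X x × act x α ≡ β)
                          × ((∃ λ x → X x × act x α ≡ β) → D β)

NeighbourTransitive : ∀ {m q} → (Aut m q → Set) → Code m q → Set
NeighbourTransitive X C = IsOrbit X C × IsOrbit X (Neighbours C)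

record IsPartition {m} (𝒥 : Subset m → Set) : Set where
  field
    nonempty : ∀ J → 𝒥 J → Nonempty J
    disjoint : ∀ J K → 𝒥 J → 𝒥 K → J ≡ K ⊎ Empty (J ∩ K)
    covers   : ∀ i → ∃ λ J → 𝒥 J × i ∈ J

imageSubset : ∀ {m} → Permutation′ m → Subset m → Subset m
imageSubset s J = tabulate λ i → lookup J (s ⟨$⟩ˡ i)

Invariant : ∀ {m q} → (Aut m q → Set) → (Subset m → Set) → Set
Invariant X 𝒥 = ∀ J x → 𝒥 J → X x → 𝒥 (imageSubset (σ x) J)

project : ∀ {m} {A : Set} (J : Subset m) → Vec A m → Vec A ∣ J ∣
project [] [] = []
project (inside ∷ J) (a ∷ α) = a ∷ project J α
project (outside ∷ J) (a ∷ α) = project J α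

projCode : ∀ {m q} (J : Subset m) → Code m q → Code ∣ J ∣ q
projCode J C γ = ∃ λ α → C α × project J α ≡ γ

-- Suppose two codewords α₀, β₀ have adjacent projections, so they differ inside J in a single
-- coordinate j₀. Neighbour transitivity supplies, for any codeword α, i ∈ J and letter a ≠ αᵢ,
-- an automorphism y mapping the neighbour α₀[j₀ ≔ β₀ⱼ₀] of α₀ to the neighbour α[i ≔ a] of α.
-- Then α₀ʸ is within distance 2 of α, so α₀ʸ = α because δ ≥ 3; consequently y moves j₀ to i,
-- fixes the block J (the blocks J and Jʸ share i), and β₀ʸ is a codeword that agrees with α on J
-- except for carrying a at i. Changing the coordinates of J one at a time, every word of
-- H(J,q) is reached, so π_J(C) would be complete.

module Submission where

open import Defs
open import Data.Nat using (ℕ)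
open import Data.Fin.Subset using (Subset)
open import Relation.Nullary using (¬_)

open import Data.Nat using (zero; suc; pred; _+_; _≤_; z≤n; s≤s)
open import Data.Nat.Properties
  using (≤-refl; ≤-reflexive; ≤-trans; ≤-antisym; n≤1+n; 1+n≰n; +-suc; +-mono-≤; +-monoʳ-≤; n≢0⇒n>0)
open import Data.Fin using (Fin; zero; suc)
open import Data.Fin.Properties using (_≟_; suc-injective)
open import Data.Fin.Permutation using (Permutation′; _⟨$⟩ʳ_; _⟨$⟩ˡ_; inverseˡ; inverseʳ)
open import Data.Fin.Subset using (_∈_; ⊤; inside; outside; ∣_∣)
open import Data.Fin.Subset.Properties using (∈⊤; _∈?_; x∈p∩q⁺)
open import Data.Vec using (Vec; []; _∷_; lookup; _[_]≔_; here; there)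
open import Data.Vec.Properties
  using ( ≡-dec; ∷-injectiveˡ; ∷-injectiveʳ; lookup∘update; lookup∘update′; lookup∘tabulate
        ; tabulate∘lookup; tabulate-cong; lookup⇒[]=; []=⇒lookup)
open import Data.List using (List; []; _∷_; allFin)
import Data.List.Relation.Unary.Any as Any
open import Data.List.Membership.Propositional using () renaming (_∈_ to _∈ₗ_)
open import Data.List.Membership.Propositional.Properties using (∈-allFin)
open import Data.Product using (∃; _×_; _,_; proj₁; proj₂)
open import Data.Sum using (inj₁; inj₂)
open import Function using (_∘_)
open import Relation.Nullary using (yes; no; contradiction)
open import Relation.Binary.PropositionalEquality
  using (_≡_; _≢_; refl; sym; trans; cong; cong₂; subst; subst₂; module ≡-Reasoning)
open ≡-Reasoning

≗-lookup⇒≡ : ∀ {n} {A : Set} (u v : Vec A n) → (∀ k → lookup u k ≡ lookup v k) → u ≡ v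
≗-lookup⇒≡ u v eq = trans (sym (tabulate∘lookup u)) (trans (tabulate-cong eq) (tabulate∘lookup v))

AgreeOn : ∀ {n} {A : Set} → Subset n → Vec A n → Vec A n → Set
AgreeOn J u v = ∀ k → k ∈ J → lookup u k ≡ lookup v k

AgreeOnExcept : ∀ {n} {A : Set} → Subset n → Fin n → Vec A n → Vec A n → Set
AgreeOnExcept J p u v = ∀ k → k ∈ J → k ≢ p → lookup u k ≡ lookup v k

agreeOnExcept-sym : ∀ {n} {A : Set} {J : Subset n} {p} (u v : Vec A n) →
  AgreeOnExcept J p u v → AgreeOnExcept J p v u
agreeOnExcept-sym _ _ u≈v k k∈J k≢p = sym (u≈v k k∈J k≢p)

[]≔-agreeOnExcept : ∀ {n} {A : Set} {J : Subset n} (u : Vec A n) j b → AgreeOnExcept J j (u [ j ]≔ b) u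
[]≔-agreeOnExcept u j b k _ k≢j = lookup∘update′ k≢j u b

module _ {q : ℕ} where

  dist-refl : ∀ {n} (u : Vertex n q) → dist u u ≡ 0
  dist-refl [] = refl
  dist-refl (a ∷ u) with a ≟ a
  ... | yes _ = dist-refl u
  ... | no a≢a = contradiction refl a≢a

  dist≡0⇒≡ : ∀ {n} (u v : Vertex n q) → dist u v ≡ 0 → u ≡ v
  dist≡0⇒≡ [] [] _ = refl
  dist≡0⇒≡ (a ∷ u) (b ∷ v) d with a ≟ b
  ... | yes a≡b = cong₂ _∷_ a≡b (dist≡0⇒≡ u v d)

  dist-triangle : ∀ {n} (u v w : Vertex n q) → dist u w ≤ dist u v + dist v w
  dist-triangle [] [] [] = z≤n
  dist-triangle (a ∷ u) (b ∷ v) (c ∷ w) with a ≟ c | a ≟ b | b ≟ c | dist-triangle u v w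
  ... | yes _   | yes _   | yes _   | tri = tri
  ... | yes _   | yes _   | no _    | tri = ≤-trans tri (+-monoʳ-≤ (dist u v) (n≤1+n _))
  ... | yes _   | no _    | yes _   | tri = ≤-trans tri (n≤1+n _)
  ... | yes _   | no _    | no _    | tri = ≤-trans tri (≤-trans (+-monoʳ-≤ (dist u v) (n≤1+n _)) (n≤1+n _))
  ... | no a≢c  | yes a≡b | yes b≡c | _   = contradiction (trans a≡b b≡c) a≢c
  ... | no _    | yes _   | no _    | tri = ≤-trans (s≤s tri) (≤-reflexive (sym (+-suc (dist u v) (dist v w))))
  ... | no _    | no _    | yes _   | tri = s≤s tri
  ... | no _    | no _    | no _    | tri = s≤s (≤-trans tri (+-monoʳ-≤ (dist u v) (n≤1+n _)))

  ≡⇒dist≡0 : ∀ {n} {u v : Vertex n q} → u ≡ v → dist u v ≡ 0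
  ≡⇒dist≡0 {u = u} refl = dist-refl u

  dist-∷-≤ : ∀ {n} (a b : Fin q) (u v : Vertex n q) → dist (a ∷ u) (b ∷ v) ≤ suc (dist u v)
  dist-∷-≤ a b _ _ with a ≟ b
  ... | yes _ = n≤1+n _
  ... | no _ = ≤-refl

  dist-∷-≡ : ∀ {n} {a b : Fin q} (u v : Vertex n q) → a ≡ b → dist (a ∷ u) (b ∷ v) ≡ dist u v
  dist-∷-≡ {a = a} {b} _ _ a≡b with a ≟ b
  ... | yes _ = refl
  ... | no a≢b = contradiction a≡b a≢b

  dist-≤1 : ∀ {n} {p : Fin n} (u v : Vertex n q) → AgreeOnExcept ⊤ p u v → dist u v ≤ 1
  dist-≤1 {p = zero} (a ∷ u) (b ∷ v) u≈v =
    ≤-trans (dist-∷-≤ a b u v) (s≤s (≤-reflexive (≡⇒dist≡0 (≗-lookup⇒≡ u v λ k → u≈v (suc k) ∈⊤ λ ()))))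
  dist-≤1 {p = suc p} (a ∷ u) (b ∷ v) u≈v =
    ≤-trans (≤-reflexive (dist-∷-≡ u v (u≈v zero ∈⊤ λ ())))
            (dist-≤1 u v λ k _ k≢p → u≈v (suc k) ∈⊤ (k≢p ∘ suc-injective))

module _ {m q : ℕ} {C : Code m q} where

  dist<δ⇒≡ : ∀ {k} {u v} → MinDistAtLeast (suc k) C → C u → C v → dist u v ≤ k → u ≡ v
  dist<δ⇒≡ {u = u} {v} δ Cu Cv d≤k with ≡-dec _≟_ u v
  ... | yes u≡v = u≡v
  ... | no u≢v = contradiction (≤-trans (δ u v Cu Cv u≢v) d≤k) 1+n≰n

  dist-[]≔ : ∀ (u : Vertex m q) j {b} → b ≢ lookup u j → dist (u [ j ]≔ b) u ≡ 1
  dist-[]≔ u j {b} b≢uⱼ = ≤-antisym (dist-≤1 (u [ j ]≔ b) u ([]≔-agreeOnExcept u j b)) (n≢0⇒n>0 λ d≡0 →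
    b≢uⱼ (trans (sym (lookup∘update j u b)) (cong (λ w → lookup w j) (dist≡0⇒≡ (u [ j ]≔ b) u d≡0))))

  []≔-neighbour : MinDistAtLeast 2 C → ∀ {α} → C α → ∀ j b → b ≢ lookup α j → Neighbours C (α [ j ]≔ b)
  []≔-neighbour δ≥2 {α} Cα j b b≢αⱼ = (α , Cα , dist-[]≔ α j b≢αⱼ) , far
    where
    ν : Vertex m q
    ν = α [ j ]≔ b

    ν∉C : ¬ C ν
    ν∉C Cν = b≢αⱼ (trans (sym (lookup∘update j α b)) (cong (λ w → lookup w j) (sym α≡ν)))
      where
      α≡ν : α ≡ ν
      α≡ν = dist<δ⇒≡ δ≥2 Cα Cν (dist-≤1 α ν (agreeOnExcept-sym ν α ([]≔-agreeOnExcept α j b)))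

    far : ∀ γ → C γ → 1 ≤ dist ν γ
    far γ Cγ = n≢0⇒n>0 λ d≡0 → ν∉C (subst C (sym (dist≡0⇒≡ ν γ d≡0)) Cγ)

module _ {m : ℕ} where

  ∈-imageSubset⁺ : ∀ (s : Permutation′ m) {J k} → s ⟨$⟩ˡ k ∈ J → k ∈ imageSubset s J
  ∈-imageSubset⁺ s {J} {k} s⁻¹k∈J =
    lookup⇒[]= k (imageSubset s J) (trans (lookup∘tabulate _ k) ([]=⇒lookup s⁻¹k∈J))

  ∈-imageSubset⁻ : ∀ (s : Permutation′ m) {J k} → k ∈ imageSubset s J → s ⟨$⟩ˡ k ∈ J
  ∈-imageSubset⁻ s {J} {k} k∈sJ =
    lookup⇒[]= (s ⟨$⟩ˡ k) J (trans (sym (lookup∘tabulate _ k)) ([]=⇒lookup k∈sJ))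

  blocks-meet⇒≡ : ∀ {𝒥 : Subset m → Set} {J K i} → IsPartition 𝒥 → 𝒥 J → 𝒥 K → i ∈ J → i ∈ K → J ≡ K
  blocks-meet⇒≡ part J∈𝒥 K∈𝒥 i∈J i∈K with IsPartition.disjoint part _ _ J∈𝒥 K∈𝒥
  ... | inj₁ J≡K = J≡K
  ... | inj₂ J∩K-empty = contradiction (_ , x∈p∩q⁺ (i∈J , i∈K)) J∩K-empty

module _ {m q : ℕ} where

  lookup-act : ∀ (x : Aut m q) (w : Vertex m q) k →
    lookup (act x w) k ≡ h x (σ x ⟨$⟩ˡ k) ⟨$⟩ʳ lookup w (σ x ⟨$⟩ˡ k)
  lookup-act x w = lookup∘tabulate _

  lookup-act-image : ∀ (x : Aut m q) (w : Vertex m q) p →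
    lookup (act x w) (σ x ⟨$⟩ʳ p) ≡ h x p ⟨$⟩ʳ lookup w p
  lookup-act-image x w p = trans (lookup-act x w _) (cong (λ l → h x l ⟨$⟩ʳ lookup w l) (inverseˡ (σ x)))

  act-mul : ∀ (x y : Aut m q) (w : Vertex m q) → act (mulAut x y) w ≡ act y (act x w)
  act-mul x y w = tabulate-cong λ k → let l = σ y ⟨$⟩ˡ k ; l′ = σ x ⟨$⟩ˡ l ; b = h x l′ ⟨$⟩ʳ lookup w l′ in
    begin
      h y (σ x ⟨$⟩ʳ l′) ⟨$⟩ʳ b        ≡⟨ cong (λ i → h y i ⟨$⟩ʳ b) (inverseʳ (σ x)) ⟩
      h y l ⟨$⟩ʳ b                    ≡⟨ cong (h y l ⟨$⟩ʳ_) (lookup-act x w l) ⟨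
      h y l ⟨$⟩ʳ lookup (act x w) l   ∎

  act-inv : ∀ (x : Aut m q) (w : Vertex m q) → act (invAut x) (act x w) ≡ w
  act-inv x w = trans (tabulate-cong λ k → begin
    h x (σ x ⟨$⟩ˡ (σ x ⟨$⟩ʳ k)) ⟨$⟩ˡ lookup (act x w) (σ x ⟨$⟩ʳ k)
      ≡⟨ cong (h x (σ x ⟨$⟩ˡ (σ x ⟨$⟩ʳ k)) ⟨$⟩ˡ_) (lookup-act-image x w k) ⟩
    h x (σ x ⟨$⟩ˡ (σ x ⟨$⟩ʳ k)) ⟨$⟩ˡ (h x k ⟨$⟩ʳ lookup w k)
      ≡⟨ cong (λ i → h x i ⟨$⟩ˡ (h x k ⟨$⟩ʳ lookup w k)) (inverseˡ (σ x)) ⟩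
    h x k ⟨$⟩ˡ (h x k ⟨$⟩ʳ lookup w k)
      ≡⟨ inverseˡ (h x k) ⟩
    lookup w k ∎) (tabulate∘lookup w)

  act-cong : ∀ (x y : Aut m q) → x ≈ᴬ y → ∀ (w : Vertex m q) → act x w ≡ act y w
  act-cong x y (hx≗hy , σx≗σy) w = tabulate-cong λ k → let lx = σ x ⟨$⟩ˡ k in begin
    h x lx ⟨$⟩ʳ lookup w lx ≡⟨ hx≗hy lx _ ⟩
    h y lx ⟨$⟩ʳ lookup w lx ≡⟨ cong (λ l → h y l ⟨$⟩ʳ lookup w l) (σ⁻¹-cong k) ⟩
    h y (σ y ⟨$⟩ˡ k) ⟨$⟩ʳ lookup w (σ y ⟨$⟩ˡ k) ∎
    where
    σ⁻¹-cong : ∀ k → σ x ⟨$⟩ˡ k ≡ σ y ⟨$⟩ˡ k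
    σ⁻¹-cong k = begin
      σ x ⟨$⟩ˡ k                          ≡⟨ cong (σ x ⟨$⟩ˡ_) (inverseʳ (σ y)) ⟨
      σ x ⟨$⟩ˡ (σ y ⟨$⟩ʳ (σ y ⟨$⟩ˡ k))   ≡⟨ cong (σ x ⟨$⟩ˡ_) (σx≗σy _) ⟨
      σ x ⟨$⟩ˡ (σ x ⟨$⟩ʳ (σ y ⟨$⟩ˡ k))   ≡⟨ inverseˡ (σ x) ⟩
      σ y ⟨$⟩ˡ k                          ∎

  act-agreeOnExcept : ∀ (x : Aut m q) {J p} (u v : Vertex m q) → AgreeOnExcept J p u v →
    AgreeOnExcept (imageSubset (σ x) J) (σ x ⟨$⟩ʳ p) (act x u) (act x v)
  act-agreeOnExcept x {p = p} u v u≈v k k∈Jˣ k≢σp = begin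
    lookup (act x u) k      ≡⟨ lookup-act x u k ⟩
    h x l ⟨$⟩ʳ lookup u l   ≡⟨ cong (h x l ⟨$⟩ʳ_) (u≈v l (∈-imageSubset⁻ (σ x) k∈Jˣ) l≢p) ⟩
    h x l ⟨$⟩ʳ lookup v l   ≡⟨ lookup-act x v k ⟨
    lookup (act x v) k      ∎
    where
    l = σ x ⟨$⟩ˡ k
    l≢p : l ≢ p
    l≢p l≡p = k≢σp (trans (sym (inverseʳ (σ x))) (cong (σ x ⟨$⟩ʳ_) l≡p))

module _ {m q : ℕ} {X : Aut m q → Set} (sg : IsSubgroup X) {D : Code m q} (orbit : IsOrbit X D) where
  open IsSubgroup sg

  private
    ω : Vertex m q
    ω = proj₁ orbit

    orbit⁻ : ∀ β → D β → ∃ λ x → X x × act x ω ≡ β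
    orbit⁻ β = proj₁ (proj₂ orbit β)

    orbit⁺ : ∀ β → (∃ λ x → X x × act x ω ≡ β) → D β
    orbit⁺ β = proj₂ (proj₂ orbit β)

  orbit-closed : ∀ {y β} → X y → D β → D (act y β)
  orbit-closed {y} {β} Xy Dβ with orbit⁻ β Dβ
  ... | x , Xx , refl with has-mul x y Xx Xy
  ... | z , Xz , z≈xy = orbit⁺ _ (z , Xz , trans (act-cong z (mulAut x y) z≈xy ω) (act-mul x y ω))

  orbit-transitive : ∀ {ν ν′} → D ν → D ν′ → ∃ λ y → X y × act y ν ≡ ν′
  orbit-transitive Dν Dν′ with orbit⁻ _ Dν | orbit⁻ _ Dν′
  ... | x₁ , X₁ , refl | x₂ , X₂ , refl with has-inv x₁ X₁
  ... | x₁⁻¹ , X₁⁻¹ , x₁⁻¹≈ with has-mul x₁⁻¹ x₂ X₁⁻¹ X₂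
  ... | z , Xz , z≈ = z , Xz , (begin
    act z (act x₁ ω)                    ≡⟨ act-cong z (mulAut x₁⁻¹ x₂) z≈ (act x₁ ω) ⟩
    act (mulAut x₁⁻¹ x₂) (act x₁ ω)     ≡⟨ act-mul x₁⁻¹ x₂ (act x₁ ω) ⟩
    act x₂ (act x₁⁻¹ (act x₁ ω))        ≡⟨ cong (act x₂) (act-cong x₁⁻¹ (invAut x₁) x₁⁻¹≈ (act x₁ ω)) ⟩
    act x₂ (act (invAut x₁) (act x₁ ω)) ≡⟨ cong (act x₂) (act-inv x₁ ω) ⟩
    act x₂ ω                            ∎)

module _ {A : Set} where

  extend : ∀ {m} (J : Subset m) → Vec A ∣ J ∣ → Vec A m → Vec A m
  extend []            []      []      = []
  extend (inside ∷ J)  (g ∷ γ) (_ ∷ w) = g ∷ extend J γ w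
  extend (outside ∷ J) γ       (a ∷ w) = a ∷ extend J γ w

  project-extend : ∀ {m} (J : Subset m) γ w → project J (extend J γ w) ≡ γ
  project-extend []            []      []      = refl
  project-extend (inside ∷ J)  (g ∷ γ) (_ ∷ w) = cong (g ∷_) (project-extend J γ w)
  project-extend (outside ∷ J) γ       (_ ∷ w) = project-extend J γ w

  project-cong : ∀ {m} (J : Subset m) (u v : Vec A m) → AgreeOn J u v → project J u ≡ project J v
  project-cong []            []      []      _   = refl
  project-cong (inside ∷ J)  (_ ∷ u) (_ ∷ v) u≈v =
    cong₂ _∷_ (u≈v zero here) (project-cong J u v λ k k∈J → u≈v (suc k) (there k∈J))
  project-cong (outside ∷ J) (_ ∷ u) (_ ∷ v) u≈v = project-cong J u v λ k k∈J → u≈v (suc k) (there k∈J)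

  project-≡⇒agreeOn : ∀ {m} (J : Subset m) (u v : Vec A m) → project J u ≡ project J v → AgreeOn J u v
  project-≡⇒agreeOn (inside ∷ J)  (_ ∷ u) (_ ∷ v) eq zero    here        = ∷-injectiveˡ eq
  project-≡⇒agreeOn (inside ∷ J)  (_ ∷ u) (_ ∷ v) eq (suc k) (there k∈J) =
    project-≡⇒agreeOn J u v (∷-injectiveʳ eq) k k∈J
  project-≡⇒agreeOn (outside ∷ J) (_ ∷ u) (_ ∷ v) eq (suc k) (there k∈J) =
    project-≡⇒agreeOn J u v eq k k∈J

project-dist≡1 : ∀ {m q} (J : Subset m) (u v : Vertex m q) → dist (project J u) (project J v) ≡ 1 →
  ∃ λ j → j ∈ J × lookup v j ≢ lookup u j × AgreeOnExcept J j v u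
project-dist≡1 [] [] [] ()
project-dist≡1 (inside ∷ J) (a ∷ u) (b ∷ v) d with a ≟ b
... | no a≢b = zero , here , a≢b ∘ sym , λ where
  zero    _           k≢0 → contradiction refl k≢0
  (suc k) (there k∈J) _   → sym (project-≡⇒agreeOn J u v (dist≡0⇒≡ _ _ (cong pred d)) k k∈J)
... | yes a≡b with project-dist≡1 J u v d
...   | j , j∈J , vⱼ≢uⱼ , v≈u = suc j , there j∈J , vⱼ≢uⱼ , λ where
  zero    _           _   → sym a≡b
  (suc k) (there k∈J) k≢j → v≈u k k∈J (k≢j ∘ cong suc)
project-dist≡1 (outside ∷ J) (_ ∷ u) (_ ∷ v) d with project-dist≡1 J u v d
... | j , j∈J , vⱼ≢uⱼ , v≈u = suc j , there j∈J , vⱼ≢uⱼ , λ where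
  (suc k) (there k∈J) k≢j → v≈u k k∈J (k≢j ∘ cong suc)

FreeOn : ∀ {m q} → Subset m → Code m q → Set
FreeOn J C = ∀ {α} i a → C α → i ∈ J → ∃ λ β → C β × lookup β i ≡ a × AgreeOnExcept J i β α

module _ {m q} {J : Subset m} {C : Code m q} (free : FreeOn J C) where

  freeOn-match : ∀ (t : Vertex m q) {c} → C c → (L : List (Fin m)) →
    ∃ λ β → C β × (∀ k → k ∈ₗ L → k ∈ J → lookup β k ≡ lookup t k)
  freeOn-match t Cc [] = _ , Cc , λ _ ()
  freeOn-match t Cc (i ∷ L) with freeOn-match t Cc L | i ∈? J
  ... | β , Cβ , β≈t | no i∉J = β , Cβ , λ where
    _ (Any.here refl) k∈J → contradiction k∈J i∉J
    k (Any.there k∈L) → β≈t k k∈L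
  ... | β , Cβ , β≈t | yes i∈J with free i (lookup t i) Cβ i∈J
  ...   | β′ , Cβ′ , β′ᵢ≡tᵢ , β′≈β = β′ , Cβ′ , β′≈t
    where
    β′≈t : ∀ k → k ∈ₗ i ∷ L → k ∈ J → lookup β′ k ≡ lookup t k
    β′≈t k k∈iL k∈J with k ≟ i | k∈iL
    ... | yes refl | _             = β′ᵢ≡tᵢ
    ... | no k≢i   | Any.here k≡i  = contradiction k≡i k≢i
    ... | no k≢i   | Any.there k∈L = trans (β′≈β k k∈J k≢i) (β≈t k k∈L k∈J)

  freeOn⇒complete : ∃ C → Complete (projCode J C)
  freeOn⇒complete (c , Cc) γ with freeOn-match (extend J γ c) Cc (allFin m)
  ... | β , Cβ , β≈t = β , Cβ , (begin
    project J β                ≡⟨ project-cong J β (extend J γ c) (λ k → β≈t k (∈-allFin k)) ⟩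
    project J (extend J γ c)   ≡⟨ project-extend J γ c ⟩
    γ                          ∎)

module CoordinateChange
  {m q} {X : Aut m q → Set} (sg : IsSubgroup X)
  {C : Code m q} (nt : NeighbourTransitive X C) (δ≥3 : MinDistAtLeast 3 C)
  {𝒥 : Subset m → Set} (part : IsPartition 𝒥) (inv : Invariant X 𝒥) {J} (J∈𝒥 : 𝒥 J)
  {α₀ β₀ : Vertex m q} {j₀} (Cα₀ : C α₀) (Cβ₀ : C β₀) (j₀∈J : j₀ ∈ J)
  (β₀ⱼ≢α₀ⱼ : lookup β₀ j₀ ≢ lookup α₀ j₀) (β₀≈α₀ : AgreeOnExcept J j₀ β₀ α₀) where

  private
    δ≥2 : MinDistAtLeast 2 C
    δ≥2 α β Cα Cβ α≢β = ≤-trans (n≤1+n 2) (δ≥3 α β Cα Cβ α≢β)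

    ν₀ : Vertex m q
    ν₀ = α₀ [ j₀ ]≔ lookup β₀ j₀

  module _ {α i a} (Cα : C α) (i∈J : i ∈ J) (a≢αᵢ : a ≢ lookup α i)
           (y : Aut m q) (Xy : X y) (ν₀ʸ≡ν : act y ν₀ ≡ α [ i ]≔ a) where

    private
      ν : Vertex m q
      ν = α [ i ]≔ a

    α₀ʸ≈ν : AgreeOnExcept ⊤ (σ y ⟨$⟩ʳ j₀) (act y α₀) ν
    α₀ʸ≈ν k _ k≢σj₀ = trans
      (act-agreeOnExcept y {J = ⊤} α₀ ν₀ (agreeOnExcept-sym ν₀ α₀ ([]≔-agreeOnExcept α₀ j₀ _)) k
        (∈-imageSubset⁺ (σ y) {J = ⊤} ∈⊤) k≢σj₀)
      (cong (λ w → lookup w k) ν₀ʸ≡ν)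

    α₀ʸ≡α : act y α₀ ≡ α
    α₀ʸ≡α = dist<δ⇒≡ δ≥3 (orbit-closed sg (proj₁ nt) Xy Cα₀) Cα
      (≤-trans (dist-triangle (act y α₀) ν α)
               (+-mono-≤ (dist-≤1 (act y α₀) ν α₀ʸ≈ν) (dist-≤1 ν α ([]≔-agreeOnExcept α i a))))

    σj₀≡i : σ y ⟨$⟩ʳ j₀ ≡ i
    σj₀≡i with i ≟ σ y ⟨$⟩ʳ j₀
    ... | yes i≡σj₀ = sym i≡σj₀
    ... | no i≢σj₀ = contradiction (begin
      a                    ≡⟨ lookup∘update i α a ⟨
      lookup ν i           ≡⟨ α₀ʸ≈ν i ∈⊤ i≢σj₀ ⟨
      lookup (act y α₀) i  ≡⟨ cong (λ w → lookup w i) α₀ʸ≡α ⟩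
      lookup α i           ∎) a≢αᵢ

    Jʸ≡J : imageSubset (σ y) J ≡ J
    Jʸ≡J = blocks-meet⇒≡ part (inv J y J∈𝒥 Xy) J∈𝒥 i∈Jʸ i∈J
      where
      i∈Jʸ : i ∈ imageSubset (σ y) J
      i∈Jʸ = subst (_∈ imageSubset (σ y) J) σj₀≡i
               (∈-imageSubset⁺ (σ y) (subst (_∈ J) (sym (inverseˡ (σ y))) j₀∈J))

    β₀ʸᵢ≡a : lookup (act y β₀) i ≡ a
    β₀ʸᵢ≡a = begin
      lookup (act y β₀) i                ≡⟨ cong (lookup (act y β₀)) σj₀≡i ⟨
      lookup (act y β₀) (σ y ⟨$⟩ʳ j₀)   ≡⟨ lookup-act-image y β₀ j₀ ⟩
      h y j₀ ⟨$⟩ʳ lookup β₀ j₀          ≡⟨ cong (h y j₀ ⟨$⟩ʳ_) (lookup∘update j₀ α₀ (lookup β₀ j₀)) ⟨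
      h y j₀ ⟨$⟩ʳ lookup ν₀ j₀          ≡⟨ lookup-act-image y ν₀ j₀ ⟨
      lookup (act y ν₀) (σ y ⟨$⟩ʳ j₀)   ≡⟨ cong₂ lookup ν₀ʸ≡ν σj₀≡i ⟩
      lookup ν i                         ≡⟨ lookup∘update i α a ⟩
      a                                  ∎

    β₀ʸ≈α : AgreeOnExcept J i (act y β₀) α
    β₀ʸ≈α = subst₂ (λ K p → AgreeOnExcept K p (act y β₀) α) Jʸ≡J σj₀≡i
      (subst (AgreeOnExcept (imageSubset (σ y) J) (σ y ⟨$⟩ʳ j₀) (act y β₀)) α₀ʸ≡α
        (act-agreeOnExcept y β₀ α₀ β₀≈α₀))

  changeCoordinate : ∀ {α i a} → C α → i ∈ J → a ≢ lookup α i →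
    ∃ λ β → C β × lookup β i ≡ a × AgreeOnExcept J i β α
  changeCoordinate {α} {i} {a} Cα i∈J a≢αᵢ
    with orbit-transitive sg (proj₂ nt) {ν₀} {α [ i ]≔ a}
           ([]≔-neighbour δ≥2 Cα₀ j₀ _ β₀ⱼ≢α₀ⱼ) ([]≔-neighbour δ≥2 Cα i a a≢αᵢ)
  ... | y , Xy , ν₀ʸ≡ν = act y β₀ , orbit-closed sg (proj₁ nt) Xy Cβ₀ ,
    β₀ʸᵢ≡a {α} {i} {a} Cα i∈J a≢αᵢ y Xy ν₀ʸ≡ν , β₀ʸ≈α {α} {i} {a} Cα i∈J a≢αᵢ y Xy ν₀ʸ≡ν

  freeOn : FreeOn J C
  freeOn {α} i a Cα i∈J with a ≟ lookup α i
  ... | yes a≡αᵢ = α , Cα , sym a≡αᵢ , λ _ _ _ → refl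
  ... | no a≢αᵢ  = changeCoordinate {α} {i} {a} Cα i∈J a≢αᵢ

corollary3p7 : ∀ {m q : ℕ} (X : Aut m q → Set) → IsSubgroup X
    → (C : Code m q) → NeighbourTransitive X C → MinDistAtLeast 3 C
    → (𝒥 : Subset m → Set) → IsPartition 𝒥 → Invariant X 𝒥
    → (J : Subset m) → 𝒥 J
    → ¬ Complete (projCode J C)
    → MinDistAtLeast 2 (projCode J C)
corollary3p7 X sg C nt δ≥3 𝒥 part inv J J∈𝒥 incomplete _ _ (α₀ , Cα₀ , refl) (β₀ , Cβ₀ , refl) γ≢γ′
  with dist (project J α₀) (project J β₀) in d
... | zero        = contradiction (dist≡0⇒≡ _ _ d) γ≢γ′
... | suc (suc _) = s≤s (s≤s z≤n)
... | suc zero with project-dist≡1 J α₀ β₀ d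
...   | j₀ , j₀∈J , β₀ⱼ≢α₀ⱼ , β₀≈α₀ = contradiction
  (freeOn⇒complete (CoordinateChange.freeOn sg nt δ≥3 part inv J∈𝒥 Cα₀ Cβ₀ j₀∈J β₀ⱼ≢α₀ⱼ β₀≈α₀) (α₀ , Cα₀))
  incomplete
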